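{- For a set-system hypergraph $H$, let $\mathrm{Del}(H)$ be the multigraph with $V(\mathrm{Del}(H))=V(H)$, $E(\mathrm{Del}(H))=\{e\in E(H):1\le|\epsilon_H(e)|\le 2\}$ and $\epsilon_{\mathrm{Del}(H)}=\epsilon_H$ restricted to this set, and let $j_H:\mathrm{Del}(H)\to H$ be the inclusion morphism. If $G$ is a multigraph and $\phi:G\to H$ is a morphism in $\mathfrak{H}$, then there is a unique morphism $\hat\phi:G\to\mathrm{Del}(H)$ in $\mathfrak{M}$ with $j_H\circ\hat\phi=\phi$.
   Context: A set-system hypergraph $G$ consists of sets $V(G)$, $E(G)$ and a function $\epsilon_G:E(G)\to\mathcal{P}(V(G))$. A morphism $\phi:G\to H$ is a pair of functions $V(\phi)$, $E(\phi)$ with $\epsilon_H\circ E(\phi)=\mathcal{P}V(\phi)\circ\epsilon_G$, where $\mathcal{P}f(A)$ is the image of $A$. This forms the category $\mathfrak{H}$. A multigraph is a set-system hypergraph with $1\le|\epsilon_G(e)|\le 2$ for all edges $e$; $\mathfrak{M}$ is the full subcategory of $\mathfrak{H}$ on multigraphs. -}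

module Defs where

open import Level using (0ℓ)
open import Data.Product using (Σ; ∃; ∃-syntax; _×_; _,_; proj₁)
open import Data.Sum using (_⊎_)
open import Relation.Unary using (Pred; _≐_)
open import Relation.Binary.PropositionalEquality using (_≡_)

-- Subsets of a set V are predicates on V; equality of subsets is
-- extensional (mutual inclusion, _≐_).
𝒫 : Set → Set₁
𝒫 V = Pred V 0ℓ

image : {V W : Set} → (V → W) → 𝒫 V → 𝒫 W
image f A w = ∃[ v ] (A v × f v ≡ w)

-- 1 ≤ |A| ≤ 2 : A = {a, b} for some a, b (a = b allowed).
OneOrTwo : {V : Set} → 𝒫 V → Set
OneOrTwo {V} A = ∃[ a ] ∃[ b ] (A ≐ (λ v → (v ≡ a) ⊎ (v ≡ b)))

record Hypergraph : Set₁ where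
  field
    V : Set
    E : Set
    ε : E → 𝒫 V
open Hypergraph public

record Hom (G H : Hypergraph) : Set where
  field
    Vmap : V G → V H
    Emap : E G → E H
    comm : ∀ e → ε H (Emap e) ≐ image Vmap (ε G e)
open Hom public

IsMultigraph : Hypergraph → Set
IsMultigraph G = ∀ e → OneOrTwo (ε G e)

_∘ₕ_ : {G H K : Hypergraph} → Hom H K → Hom G H → Hom G K
_∘ₕ_ {G} {H} {K} ψ φ = record
  { Vmap = λ v → Vmap ψ (Vmap φ v)
  ; Emap = λ e → Emap ψ (Emap φ e)
  ; comm = λ e → ( (λ {w} x → lemma₁ e x) , (λ {w} x → lemma₂ e x) ) }
  where
  open import Data.Product using (proj₂)
  open import Relation.Binary.PropositionalEquality using (refl; cong; trans)
  lemma₁ : ∀ e {w} → ε K (Emap ψ (Emap φ e)) w → image (λ v → Vmap ψ (Vmap φ v)) (ε G e) w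
  lemma₁ e x with proj₁ (comm ψ (Emap φ e)) x
  ... | (u , u∈ , refl) with proj₁ (comm φ e) u∈
  ... | (v , v∈ , refl) = v , v∈ , refl
  lemma₂ : ∀ e {w} → image (λ v → Vmap ψ (Vmap φ v)) (ε G e) w → ε K (Emap ψ (Emap φ e)) w
  lemma₂ e (v , v∈ , refl) = proj₂ (comm ψ (Emap φ e)) (Vmap φ v , proj₂ (comm φ e) (v , v∈ , refl) , refl)

-- Equality of morphisms: equality of the underlying vertex and edge maps
-- (pointwise, as Agda lacks function extensionality).
_≈ₕ_ : {G H : Hypergraph} → Hom G H → Hom G H → Set
φ ≈ₕ ψ = (∀ v → Vmap φ v ≡ Vmap ψ v) × (∀ e → Emap φ e ≡ Emap ψ e)

-- Del(H): keep only edges of size 1 or 2.  An edge of Del(H) is an edge of H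
-- together with a witness that it has size 1 or 2; since such witnesses are
-- not unique in Agda, edges of Del(H) are compared via their underlying
-- edge of H (see _≈ᴰ_ below), matching the subset reading of the paper.
Del : Hypergraph → Hypergraph
Del H = record
  { V = V H
  ; E = Σ (E H) (λ e → OneOrTwo (ε H e))
  ; ε = λ e → ε H (proj₁ e) }

j : (H : Hypergraph) → Hom (Del H) H
j H = record
  { Vmap = λ v → v
  ; Emap = proj₁
  ; comm = λ e → ( (λ x → _ , x , refl) , (λ { (_ , x , refl) → x }) ) }
  where open import Relation.Binary.PropositionalEquality using (refl)

_≈ᴰ_ : {G H : Hypergraph} → Hom G (Del H) → Hom G (Del H) → Set
φ ≈ᴰ ψ = (∀ v → Vmap φ v ≡ Vmap ψ v) × (∀ e → proj₁ (Emap φ e) ≡ proj₁ (Emap ψ e))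

module Submission where

-- Since the
-- direct image of a set {a, b} under any map f is {f a, f b}, edges of a
-- multigraph are sent to edges of size 1 or 2, i.e. φ lands in Del(H).
-- Hence φ̂ is just φ with its codomain restricted: same vertex map, same
-- edge map, each edge tagged with the size witness, and the morphism
-- condition is inherited verbatim because ε_{Del H} is ε_H restricted.
-- Uniqueness is immediate: j_H is the identity on vertices and forgets the
-- size witness on edges, so j_H ∘ ψ = φ pins down the vertex map and the
-- underlying edges of ψ.

open import Defs
open import Data.Product using (Σ; _×_; _,_; proj₁; proj₂)
open import Data.Sum using (_⊎_; inj₁; inj₂)
open import Relation.Unary using (_≐_)
open import Relation.Binary.PropositionalEquality using (_≡_; refl)

image-OneOrTwo : {V W : Set} (f : V → W) (A : 𝒫 V) →
                 OneOrTwo A → OneOrTwo (image f A)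
image-OneOrTwo f A (a , b , A⊆ab , ab⊆A) = f a , f b , image⊆ , ⊆image
  where
  image⊆ : ∀ {w} → image f A w → (w ≡ f a) ⊎ (w ≡ f b)
  image⊆ (v , v∈A , refl) with A⊆ab v∈A
  ... | inj₁ refl = inj₁ refl
  ... | inj₂ refl = inj₂ refl

  ⊆image : ∀ {w} → (w ≡ f a) ⊎ (w ≡ f b) → image f A w
  ⊆image (inj₁ refl) = a , ab⊆A (inj₁ refl) , refl
  ⊆image (inj₂ refl) = b , ab⊆A (inj₂ refl) , refl

OneOrTwo-resp-≐ : {V : Set} {A B : 𝒫 V} → A ≐ B → OneOrTwo B → OneOrTwo A
OneOrTwo-resp-≐ (A⊆B , B⊆A) (a , b , B⊆ab , ab⊆B) =
  a , b , (λ v∈A → B⊆ab (A⊆B v∈A)) , (λ v∈ab → B⊆A (ab⊆B v∈ab))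

Del-isMultigraph : (H : Hypergraph) → IsMultigraph (Del H)
Del-isMultigraph H (e , e-size) = e-size

Emap-OneOrTwo : (G H : Hypergraph) → IsMultigraph G → (φ : Hom G H) →
                ∀ e → OneOrTwo (ε H (Emap φ e))
Emap-OneOrTwo G H G-multi φ e =
  OneOrTwo-resp-≐ (comm φ e) (image-OneOrTwo (Vmap φ) (ε G e) (G-multi e))

corestrict : (G H : Hypergraph) (φ : Hom G H) →
             (∀ e → OneOrTwo (ε H (Emap φ e))) → Hom G (Del H)
corestrict G H φ φ-size = record
  { Vmap = Vmap φ
  ; Emap = λ e → Emap φ e , φ-size e
  ; comm = comm φ }

j∘corestrict : (G H : Hypergraph) (φ : Hom G H)
               (φ-size : ∀ e → OneOrTwo (ε H (Emap φ e))) →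
               (j H ∘ₕ corestrict G H φ φ-size) ≈ₕ φ
j∘corestrict G H φ φ-size = (λ v → refl) , (λ e → refl)

j-cancel : (G H : Hypergraph) (ψ χ : Hom G (Del H)) →
           (j H ∘ₕ ψ) ≈ₕ (j H ∘ₕ χ) → ψ ≈ᴰ χ
j-cancel G H ψ χ (sameV , sameE) = sameV , sameE

mainTheorem8 : (G H : Hypergraph) → IsMultigraph G → (φ : Hom G H) →
    IsMultigraph (Del H) ×
    Σ (Hom G (Del H)) (λ φ̂ →
      ((j H ∘ₕ φ̂) ≈ₕ φ) ×
      ((ψ : Hom G (Del H)) → (j H ∘ₕ ψ) ≈ₕ φ → ψ ≈ᴰ φ̂))
mainTheorem8 G H G-multi φ =
  Del-isMultigraph H , φ̂ , j∘corestrict G H φ φ-size , unique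
  where
  φ-size : ∀ e → OneOrTwo (ε H (Emap φ e))
  φ-size = Emap-OneOrTwo G H G-multi φ

  φ̂ : Hom G (Del H)
  φ̂ = corestrict G H φ φ-size

  -- j_H ∘ ψ = φ = j_H ∘ φ̂ definitionally, so cancel j_H.
  unique : (ψ : Hom G (Del H)) → (j H ∘ₕ ψ) ≈ₕ φ → ψ ≈ᴰ φ̂
  unique ψ = j-cancel G H ψ φ̂
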